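{- Let $(V,\circ)$ be a Steiner quasigroup and consider its Cayley table. Let $r\neq r'$ be two rows, and let $R$ be a row cycle between row $r$ and row $r'$ whose set of columns $C$ and set of symbols $S$ satisfy $C,S\subseteq V\setminus\{r,r'\}$. Then $C$ and $S$ are disjoint, and there exists a row cycle $R'\neq R$ between rows $r$ and $r'$ whose set of columns is $S$ and whose set of symbols is $C$.
   Context: A quasigroup $(Q,\circ)$ is a finite nonempty set with a binary operation whose Cayley table (entry in row $x$, column $y$ is $x\circ y$) is a Latin square. It is idempotent if $x\circ x=x$ for all $x$, commutative if $x\circ y=y\circ x$ for all $x,y$, and semisymmetric if $x\circ y=z$ implies $y\circ z=x$ (and hence $z\circ x=y$). A Steiner quasigroup is an idempotent, commutative, semisymmetric quasigroup. For rows $r,r'$ of a Latin square let $\sigma$ be the permutation of symbols with $\sigma(r\circ c)=r'\circ c$ for every column $c$; a row cycle between rows $r,r'$ consists of the cells in rows $r,r'$ and in the columns $c$ for which $r\circ c$ lies in a single cycle of $\sigma$ (equivalently, a $2\times k$ Latin subrectangle in those rows that is minimal under containment). Its columns are those columns $c$ and its symbols are the symbols occurring in it. -}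

module Defs where

open import Data.Nat using (ℕ)
open import Data.Fin using (Fin)
open import Data.Fin.Subset using (Subset; _∈_)
open import Data.Product using (_×_; Σ; ∃)
open import Data.Sum using (_⊎_)
open import Function.Definitions using (Bijective)
open import Function.Bundles using (_⇔_)
open import Relation.Binary.PropositionalEquality using (_≡_)

Op : ℕ → Set
Op n = Fin n → Fin n → Fin n

IsQuasigroup : ∀ {n} → Op n → Set
IsQuasigroup {n} op =
  (∀ x → Bijective _≡_ _≡_ (λ y → op x y)) ×
  (∀ y → Bijective _≡_ _≡_ (λ x → op x y))

IsIdempotent : ∀ {n} → Op n → Set
IsIdempotent op = ∀ x → op x x ≡ x

IsCommutative : ∀ {n} → Op n → Set
IsCommutative op = ∀ x y → op x y ≡ op y x

IsSemisymmetric : ∀ {n} → Op n → Set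
IsSemisymmetric op = ∀ x y z → op x y ≡ z → op y z ≡ x

IsSteinerQuasigroup : ∀ {n} → Op n → Set
IsSteinerQuasigroup op =
  IsQuasigroup op × IsIdempotent op × IsCommutative op × IsSemisymmetric op

-- σ is the symbol permutation with σ (r ∘ c) = r' ∘ c.  On columns this
-- induces the successor relation c ↦ d where r ∘ d = σ (r ∘ c) = r' ∘ c.
-- Reach op r r' c d : r ∘ d = σ^k (r ∘ c) for some k ≥ 0, i.e. r ∘ d lies
-- in the σ-cycle of r ∘ c.
data Reach {n} (op : Op n) (r r' : Fin n) (c : Fin n) : Fin n → Set where
  here : Reach op r r' c c
  step : ∀ {d e} → Reach op r r' c d → op r e ≡ op r' d → Reach op r r' c e

-- A row cycle between rows r and r' (cells: rows r, r' and columns in C)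
-- is determined by its column set C: the columns c with r ∘ c in a single
-- cycle of σ.
IsRowCycle : ∀ {n} → Op n → Fin n → Fin n → Subset n → Set
IsRowCycle op r r' C = ∃ λ c₀ → ∀ d → (d ∈ C) ⇔ Reach op r r' c₀ d

IsSymbolOf : ∀ {n} → Op n → Fin n → Fin n → Subset n → Fin n → Set
IsSymbolOf op r r' C s = ∃ λ c → c ∈ C × (s ≡ op r c ⊎ s ≡ op r' c)

-- Let a x = r∘x and b x = r'∘x.  Both are involutions, and the columns of a row cycle
-- between r and r' form an orbit of next = a ∘ b.  Since a ∘ next = next⁻¹ ∘ a, the
-- reflection a maps orbits of next onto orbits of next.  The symbols of the cycle on
-- columns C are exactly a(C), so a(C) is the column set of a row cycle whose symbols
-- are a(a(C)) = C.  If a(C) met C, then a would send some column of the cycle to one at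
-- distance d further along it; a sends the successor of that column to distance d − 2,
-- and distance 0 or 1 forces a column equal to r or r', which is excluded.
module Submission where

open import Defs
open import Data.Nat using (ℕ; zero; suc; _+_)
open import Data.Nat.Properties using (+-suc; +-comm; ≤-total; m≤n⇒∃[o]m+o≡n; n<1+n)
open import Data.Fin using (Fin; toℕ)
open import Data.Fin.Properties using (pigeonhole)
open import Data.Fin.Subset using (Subset; _∈_)
open import Data.Vec using (tabulate; lookup)
open import Data.Vec.Properties using ([]=⇒lookup; lookup⇒[]=; lookup∘tabulate)
open import Data.Empty using (⊥)
open import Data.Product using (_×_; Σ; ∃; _,_; proj₁; proj₂)
open import Data.Sum using (_⊎_; inj₁; inj₂; [_,_])
open import Function.Base using (_∘_)
open import Function.Bundles using (_⇔_; mk⇔; Equivalence)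
open import Function.Definitions using (Injective)
import Function.Endo.Propositional as Endo
open import Function.Properties.Equivalence using () renaming (sym to ⇔-sym; trans to ⇔-trans)
open import Relation.Binary.PropositionalEquality
  using (_≡_; _≢_; refl; sym; trans; cong; subst; module ≡-Reasoning)
open import Relation.Nullary using (¬_)

open Equivalence using (to; from)

preimage : ∀ {m n} → (Fin m → Fin n) → Subset n → Subset m
preimage h C = tabulate (λ x → lookup C (h x))

∈-preimage : ∀ {m n} {h : Fin m → Fin n} {C : Subset n} {x : Fin m} →
  (x ∈ preimage h C) ⇔ (h x ∈ C)
∈-preimage {h = h} {C} {x} = mk⇔
  (λ x∈ → lookup⇒[]= (h x) C (trans (sym (lookup∘tabulate _ x)) ([]=⇒lookup x∈)))
  (λ hx∈ → lookup⇒[]= x (preimage h C) (trans (lookup∘tabulate _ x) ([]=⇒lookup hx∈)))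

module _ {n : ℕ} where
  open Endo (Fin n) using (_^_)

  Orbit : (Fin n → Fin n) → Fin n → Fin n → Set
  Orbit f c d = ∃ λ k → (f ^ k) c ≡ d

  ^-conjugate : ∀ {f g h : Fin n → Fin n} → (∀ x → h (f x) ≡ g (h x)) →
    ∀ k x → h ((f ^ k) x) ≡ (g ^ k) (h x)
  ^-conjugate hf≡gh zero    x = refl
  ^-conjugate {g = g} hf≡gh (suc k) x = trans (hf≡gh _) (cong g (^-conjugate hf≡gh k x))

  module _ {f : Fin n → Fin n} (f-injective : Injective _≡_ _≡_ f) where

    ^-cancelˡ : ∀ i d y → (f ^ (i + d)) y ≡ (f ^ i) y → (f ^ d) y ≡ y
    ^-cancelˡ zero    d y e = e
    ^-cancelˡ (suc i) d y e = ^-cancelˡ i d y (f-injective e)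

    ^-periodic : ∀ y → ∃ λ p → (f ^ suc p) y ≡ y
    ^-periodic y with pigeonhole (n<1+n n) (λ i → (f ^ toℕ i) y)
    ... | i , j , i<j , fⁱy≡fʲy with m≤n⇒∃[o]m+o≡n i<j
    ... | k , i+1+k≡j = k , ^-cancelˡ (toℕ i) (suc k) y
      (trans (cong (λ m → (f ^ m) y) (trans (+-suc (toℕ i) k) i+1+k≡j)) (sym fⁱy≡fʲy))

  module _ {f g : Fin n → Fin n} (g∘f≗id : ∀ x → g (f x) ≡ x) where

    private
      f-injective : Injective _≡_ _≡_ f
      f-injective {x} {y} e = trans (sym (g∘f≗id x)) (trans (cong g e) (g∘f≗id y))

    orbit-next : ∀ {c d} → Orbit f c d → Orbit f c (f d)
    orbit-next (k , fᵏc≡d) = suc k , cong f fᵏc≡d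

    orbit-prev : ∀ {c d} → Orbit f c d → Orbit f c (g d)
    orbit-prev (suc k , fᵏ⁺¹c≡d) = k , trans (sym (g∘f≗id _)) (cong g fᵏ⁺¹c≡d)
    orbit-prev {c} (zero , refl) with ^-periodic f-injective c
    ... | p , fᵖ⁺¹c≡c = p , trans (sym (g∘f≗id _)) (cong g fᵖ⁺¹c≡c)

    orbit-prev^ : ∀ {c d} k → Orbit f c d → Orbit f c ((g ^ k) d)
    orbit-prev^ zero    o = o
    orbit-prev^ (suc k) o = orbit-prev (orbit-prev^ k o)

    orbit-reverse : ∀ {h : Fin n → Fin n} → (∀ x → h (f x) ≡ g (h x)) →
      ∀ {c d} → Orbit f c d → Orbit f (h c) (h d)
    orbit-reverse hf≡gh {c} (k , refl) =
      subst (Orbit f _) (sym (^-conjugate hf≡gh k c)) (orbit-prev^ k (0 , refl))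

  module SteinerRows (op : Op n) (steiner : IsSteinerQuasigroup op) (r r' : Fin n) where

    private
      quasigroup = proj₁ steiner
      idempotent = proj₁ (proj₂ steiner)
      commutative = proj₁ (proj₂ (proj₂ steiner))
      semisymmetric = proj₂ (proj₂ (proj₂ steiner))

    row-injective : ∀ u → Injective _≡_ _≡_ (op u)
    row-injective u = proj₁ (proj₁ quasigroup u)

    row-involutive : ∀ u x → op u (op u x) ≡ x
    row-involutive u x =
      trans (commutative u _) (semisymmetric x (op u x) u (semisymmetric u x _ refl))

    fixed⇒≡row : ∀ u x → op u x ≡ x → x ≡ u
    fixed⇒≡row u x ux≡x = sym (proj₁ (proj₂ quasigroup x) (trans ux≡x (sym (idempotent x))))

    next prev : Fin n → Fin n
    next x = op r (op r' x)
    prev x = op r' (op r x)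

    prev∘next : ∀ x → prev (next x) ≡ x
    prev∘next x = trans (cong (op r') (row-involutive r _)) (row-involutive r' x)

    reflect-next : ∀ x → op r (next x) ≡ prev (op r x)
    reflect-next x =
      trans (row-involutive r _) (cong (op r') (sym (row-involutive r x)))

    Reach⇔Orbit : ∀ {c d} → Reach op r r' c d ⇔ Orbit next c d
    Reach⇔Orbit {c} = mk⇔ reach⇒orbit (λ { (k , refl) → reach-next^ k })
      where
        reach⇒orbit : ∀ {d} → Reach op r r' c d → Orbit next c d
        reach⇒orbit here = 0 , refl
        reach⇒orbit (step {d} {e} reach re≡r'd) with reach⇒orbit reach
        ... | k , nextᵏc≡d =
          suc k , trans (cong next nextᵏc≡d)
                        (trans (cong (op r) (sym re≡r'd)) (row-involutive r e))

        reach-next^ : ∀ k → Reach op r r' c ((next ^ k) c)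
        reach-next^ zero    = here
        reach-next^ (suc k) = step (reach-next^ k) (row-involutive r _)

    reflect-orbit : ∀ {c d} → Orbit next c d → Orbit next (op r c) (op r d)
    reflect-orbit = orbit-reverse {f = next} {g = prev} prev∘next {h = op r} reflect-next

    orbit-reflect⇔ : ∀ {c d} → Orbit next c (op r d) ⇔ Orbit next (op r c) d
    orbit-reflect⇔ {c} {d} = mk⇔
      (λ o → subst (Orbit next _) (row-involutive r d) (reflect-orbit o))
      (λ o → subst (λ c′ → Orbit next c′ _) (row-involutive r c) (reflect-orbit o))

    MeetsRows : Fin n → Set
    MeetsRows c = Orbit next c r ⊎ Orbit next c r'

    reflection-at-distance : ∀ {c} d i → op r ((next ^ i) c) ≡ (next ^ (d + i)) c →
      MeetsRows c
    reflection-at-distance zero i e = inj₁ (i , fixed⇒≡row r _ e)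
    reflection-at-distance (suc zero) i e =
      inj₂ (i , fixed⇒≡row r' _ (sym (row-injective r e)))
    reflection-at-distance {c} (suc (suc d)) i e = reflection-at-distance d (suc i) (begin
      op r (next (F i))             ≡⟨ reflect-next (F i) ⟩
      prev (op r (F i))             ≡⟨ cong prev e ⟩
      prev (next (F (suc (d + i)))) ≡⟨ prev∘next _ ⟩
      F (suc (d + i))               ≡⟨ cong F (sym (+-suc d i)) ⟩
      F (d + suc i)                 ∎)
      where
        open ≡-Reasoning
        F : ℕ → Fin n
        F k = (next ^ k) c

    reflection-in-orbit⇒MeetsRows : ∀ {c x} → Orbit next c x → Orbit next c (op r x) →
      MeetsRows c
    reflection-in-orbit⇒MeetsRows {c} (i , refl) (j , Fj≡rFi) with ≤-total i j
    ... | inj₁ i≤j with m≤n⇒∃[o]m+o≡n i≤j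
    ...   | k , i+k≡j = reflection-at-distance k i
      (trans (sym Fj≡rFi) (cong (λ m → (next ^ m) c) (sym (trans (+-comm k i) i+k≡j))))
    reflection-in-orbit⇒MeetsRows {c} (i , refl) (j , Fj≡rFi) | inj₂ j≤i with m≤n⇒∃[o]m+o≡n j≤i
    ...   | k , j+k≡i = reflection-at-distance k j
      (trans (trans (cong (op r) Fj≡rFi) (row-involutive r _))
             (cong (λ m → (next ^ m) c) (sym (trans (+-comm k j) j+k≡i))))

    IsSymbolOf⇔reflection∈ : ∀ {C} → (∀ {c} → c ∈ C → next c ∈ C) →
      ∀ {s} → IsSymbolOf op r r' C s ⇔ (op r s ∈ C)
    IsSymbolOf⇔reflection∈ {C} next-closed {s} = mk⇔ symbol⇒reflection∈
      (λ rs∈C → op r s , rs∈C , inj₁ (sym (row-involutive r s)))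
      where
        symbol⇒reflection∈ : IsSymbolOf op r r' C s → op r s ∈ C
        symbol⇒reflection∈ (c , c∈C , inj₁ refl) = subst (_∈ C) (sym (row-involutive r c)) c∈C
        symbol⇒reflection∈ (c , c∈C , inj₂ refl) = next-closed c∈C

    module RowCycle {c₀ : Fin n} {C : Subset n}
                    (cycle : ∀ d → (d ∈ C) ⇔ Reach op r r' c₀ d)
                    (avoids-rows : ∀ c → c ∈ C → c ≢ r × c ≢ r') where

      ∈⇔Orbit : ∀ {d} → (d ∈ C) ⇔ Orbit next c₀ d
      ∈⇔Orbit {d} = ⇔-trans (cycle d) Reach⇔Orbit

      next-closed : ∀ {c} → c ∈ C → next c ∈ C
      next-closed = from ∈⇔Orbit ∘ orbit-next {f = next} {g = prev} prev∘next ∘ to ∈⇔Orbit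

      prev-closed : ∀ {c} → c ∈ C → prev c ∈ C
      prev-closed = from ∈⇔Orbit ∘ orbit-prev {f = next} {g = prev} prev∘next ∘ to ∈⇔Orbit

      ∈⇒reflection∉ : ∀ {x} → x ∈ C → op r x ∈ C → ⊥
      ∈⇒reflection∉ x∈C rx∈C =
        [ (λ o → proj₁ (avoids-rows r (from ∈⇔Orbit o)) refl)
        , (λ o → proj₂ (avoids-rows r' (from ∈⇔Orbit o)) refl)
        ] (reflection-in-orbit⇒MeetsRows (to ∈⇔Orbit x∈C) (to ∈⇔Orbit rx∈C))

      columns-disjoint-symbols : ∀ x → x ∈ C → ¬ IsSymbolOf op r r' C x
      columns-disjoint-symbols x x∈C symbol =
        ∈⇒reflection∉ x∈C (to (IsSymbolOf⇔reflection∈ next-closed) symbol)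

      Reflected : Subset n
      Reflected = preimage (op r) C

      Reflected-isRowCycle : ∀ d → (d ∈ Reflected) ⇔ Reach op r r' (op r c₀) d
      Reflected-isRowCycle d =
        ⇔-trans ∈-preimage (⇔-trans ∈⇔Orbit (⇔-trans orbit-reflect⇔ (⇔-sym Reach⇔Orbit)))

      Reflected≢C : Reflected ≢ C
      Reflected≢C Reflected≡C =
        ∈⇒reflection∉ c₀∈C (to ∈-preimage (subst (c₀ ∈_) (sym Reflected≡C) c₀∈C))
        where
          c₀∈C : c₀ ∈ C
          c₀∈C = from ∈⇔Orbit (0 , refl)

      Reflected-next-closed : ∀ {c} → c ∈ Reflected → next c ∈ Reflected
      Reflected-next-closed {c} c∈ =
        from ∈-preimage (subst (_∈ C) (sym (reflect-next c)) (prev-closed (to ∈-preimage c∈)))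

      Reflected-columns : ∀ c → (c ∈ Reflected) ⇔ IsSymbolOf op r r' C c
      Reflected-columns c = ⇔-trans ∈-preimage (⇔-sym (IsSymbolOf⇔reflection∈ next-closed))

      Reflected-symbols : ∀ s → IsSymbolOf op r r' Reflected s ⇔ (s ∈ C)
      Reflected-symbols s = ⇔-trans (IsSymbolOf⇔reflection∈ Reflected-next-closed)
        (⇔-trans ∈-preimage (mk⇔ (subst (_∈ C) (row-involutive r s))
                                 (subst (_∈ C) (sym (row-involutive r s)))))

lemma4p1 : ∀ {n} (op : Op n) → IsSteinerQuasigroup op →
    (r r' : Fin n) → r ≢ r' →
    (C : Subset n) → IsRowCycle op r r' C →
    (∀ c → c ∈ C → c ≢ r × c ≢ r') →
    (∀ s → IsSymbolOf op r r' C s → s ≢ r × s ≢ r') →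
    (∀ x → x ∈ C → ¬ IsSymbolOf op r r' C x) ×
    Σ (Subset n) (λ C' → IsRowCycle op r r' C' × C' ≢ C ×
      (∀ c → (c ∈ C') ⇔ IsSymbolOf op r r' C c) ×
      (∀ s → IsSymbolOf op r r' C' s ⇔ (s ∈ C)))
lemma4p1 op steiner r r' _ C (c₀ , cycle) avoids-rows _ =
  columns-disjoint-symbols , Reflected , (op r c₀ , Reflected-isRowCycle) , Reflected≢C ,
  Reflected-columns , Reflected-symbols
  where
    open SteinerRows op steiner r r'
    open RowCycle cycle avoids-rows
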